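{- Let $A$ be the Conway sequence: $A(1)=A(2)=1$ and $A(n)=A(n-A(n-1))+A(A(n-1))$ for $n\ge3$. Define the maternal generation sequence $M_1$ by $M_1(1)=M_1(2)=1$ and $M_1(n)=M_1(n-A(n-1))+1$ for $n\ge 3$, and let $\alpha_1(g)=\min\{n: M_1(n)=g\}$. Then $\alpha_1(g)=2^{g-1}+1$ for all $g>1$.
   Context: $M_1$ is the generation sequence of $A$ based on the spot function $S_1(n)=n-A(n-1)$; $\alpha_1(g)$ is the beginning of the $g$-th maternal generation. -}

module Defs where

open import Data.Nat using (ℕ; zero; suc; _+_; _∸_; _<_; _≤_)
open import Data.List using (List; []; _∷_; _++_; [_]; length)

at : List ℕ → ℕ → ℕ
at []       _       = 0
at (x ∷ xs) zero    = x
at (x ∷ xs) (suc i) = at xs i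

-- Conway sequence table: tableA n = [A(0), A(1), ..., A(n)],
-- with the dummy value A(0) = 0 (never used for n ≥ 1).
-- A(1) = A(2) = 1, A(n) = A(n - A(n-1)) + A(A(n-1)) for n ≥ 3.
stepA : List ℕ → ℕ → ℕ
stepA t n = let p = at t (n ∸ 1) in at t (n ∸ p) + at t p

tableA : ℕ → List ℕ
tableA zero = 0 ∷ []
tableA (suc zero) = 0 ∷ 1 ∷ []
tableA (suc (suc zero)) = 0 ∷ 1 ∷ 1 ∷ []
tableA (suc (suc (suc k))) =
  let t = tableA (suc (suc k)) in t ++ [ stepA t (suc (suc (suc k))) ]

A : ℕ → ℕ
A n = at (tableA n) n

tableM : ℕ → List ℕ
tableM zero = 0 ∷ []
tableM (suc zero) = 0 ∷ 1 ∷ []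
tableM (suc (suc zero)) = 0 ∷ 1 ∷ 1 ∷ []
tableM (suc (suc (suc k))) =
  let t = tableM (suc (suc k)) ; n = suc (suc (suc k))
  in t ++ [ suc (at t (n ∸ A (n ∸ 1))) ]

M₁ : ℕ → ℕ
M₁ n = at (tableM n) n

-- Write S₁(n) = n − A(n−1) for the spot function, so that for n ≥ 3
--   A(n) = A(S₁ n) + A(A(n−1))   with   S₁ n + A(n−1) = n,
--   M₁(n) = M₁(S₁ n) + 1.
-- The proof shows that M₁ is constant, equal to k+1, on each dyadic block
-- 2^k < n ≤ 2^(k+1); the theorem is then immediate.  The steps are:
--   1. the tables of Defs compute A and M₁ by their recurrences (a general
--      fact about tables built by appending one entry at a time);
--   2. n/2 ≤ A(n) ≤ n for n ≥ 1, since these bounds are preserved by sums;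
--   3. A(n) ≤ 2^k for n ≤ 2^(k+1), and A(m) + 2^j ≤ m for m ≥ 2^(j+1),
--      both by strong induction along the recurrence;
--   4. by (2) and (3) the spot of an index in block k+1 lies in block k,
--      so M₁ climbs by exactly one generation from block to block.
module Submission where

open import Defs
open import Data.Nat using (ℕ; suc; _+_; _∸_; _^_; _<_; _≤_)
open import Relation.Binary.PropositionalEquality using (_≡_; _≢_)
open import Data.Product using (_×_)

open import Data.Nat using (zero; _*_; z≤n; s≤s; _≤?_)
open import Data.Nat.Properties
open import Data.Nat.Induction using (<-rec)
open import Data.Product using (_,_)
open import Data.Sum using (inj₁; inj₂)
open import Data.List using (List; []; _∷_; _++_; [_]; length)
open import Data.List.Properties using (length-++)
open import Relation.Nullary using (yes; no)
open import Relation.Binary.PropositionalEquality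
  using (refl; sym; trans; cong; cong₂; subst; subst₂; module ≡-Reasoning)
open import Algebra.Properties.CommutativeSemigroup +-commutativeSemigroup
  using (interchange)

at-snoc-init : ∀ t x i → i < length t → at (t ++ [ x ]) i ≡ at t i
at-snoc-init (y ∷ t) x zero    _         = refl
at-snoc-init (y ∷ t) x (suc i) (s≤s i<t) = at-snoc-init t x i i<t

at-snoc-last : ∀ t x → at (t ++ [ x ]) (length t) ≡ x
at-snoc-last []      x = refl
at-snoc-last (y ∷ t) x = at-snoc-last t x

module SnocTable (T : ℕ → List ℕ) (new : ℕ → ℕ)
                 (length-T-zero : length (T 0) ≡ 1)
                 (T-suc : ∀ n → T (suc n) ≡ T n ++ [ new n ]) where

  length-T : ∀ n → length (T n) ≡ suc n
  length-T zero    = length-T-zero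
  length-T (suc n) = begin
    length (T (suc n))          ≡⟨ cong length (T-suc n) ⟩
    length (T n ++ [ new n ])   ≡⟨ length-++ (T n) ⟩
    length (T n) + 1            ≡⟨ +-comm (length (T n)) 1 ⟩
    suc (length (T n))          ≡⟨ cong suc (length-T n) ⟩
    suc (suc n)                 ∎
    where open ≡-Reasoning

  at-T-suc : ∀ n i → i ≤ n → at (T (suc n)) i ≡ at (T n) i
  at-T-suc n i i≤n rewrite T-suc n =
    at-snoc-init (T n) (new n) i (subst (i <_) (sym (length-T n)) (s≤s i≤n))

  at-T : ∀ n i → i ≤ n → at (T n) i ≡ at (T i) i
  at-T n i i≤n with m≤n⇒m<n∨m≡n i≤n
  ... | inj₂ refl = refl
  at-T (suc n) i _ | inj₁ (s≤s i≤n) = trans (at-T-suc n i i≤n) (at-T n i i≤n)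

  at-T-last : ∀ n → at (T (suc n)) (suc n) ≡ new n
  at-T-last n rewrite T-suc n =
    subst (λ j → at (T n ++ [ new n ]) j ≡ new n) (length-T n)
          (at-snoc-last (T n) (new n))

S₁ : ℕ → ℕ
S₁ n = n ∸ A (n ∸ 1)

newA : ℕ → ℕ
newA zero               = 1
newA (suc zero)         = 1
newA n@(suc (suc _))    = stepA (tableA n) (suc n)

newM : ℕ → ℕ
newM zero               = 1
newM (suc zero)         = 1
newM n@(suc (suc _))    = suc (at (tableM n) (suc n ∸ A n))

tableA-suc : ∀ n → tableA (suc n) ≡ tableA n ++ [ newA n ]
tableA-suc zero          = refl
tableA-suc (suc zero)    = refl
tableA-suc (suc (suc _)) = refl

tableM-suc : ∀ n → tableM (suc n) ≡ tableM n ++ [ newM n ]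
tableM-suc zero          = refl
tableM-suc (suc zero)    = refl
tableM-suc (suc (suc _)) = refl

module TableA = SnocTable tableA newA refl tableA-suc
module TableM = SnocTable tableM newM refl tableM-suc

-- Conway's recurrence, at n = m + 1 ≥ 3; the bounds on A m make both
-- arguments S₁ (suc m) and A m earlier indices.
A-rec : ∀ m → 2 ≤ m → 1 ≤ A m → A m ≤ m →
        A (suc m) ≡ A (S₁ (suc m)) + A (A m)
A-rec (suc zero) (s≤s ()) _ _
A-rec m@(suc (suc _)) _ 1≤Am Am≤m = begin
  A (suc m)                                           ≡⟨ TableA.at-T-last m ⟩
  at (tableA m) (S₁ (suc m)) + at (tableA m) (A m)    ≡⟨ cong₂ _+_
                                                           (TableA.at-T m _ (∸-monoʳ-≤ (suc m) 1≤Am))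
                                                           (TableA.at-T m _ Am≤m) ⟩
  A (S₁ (suc m)) + A (A m)                            ∎
  where open ≡-Reasoning

M-rec : ∀ m → 2 ≤ m → 1 ≤ A m → M₁ (suc m) ≡ suc (M₁ (S₁ (suc m)))
M-rec (suc zero) (s≤s ()) _
M-rec m@(suc (suc _)) _ 1≤Am =
  trans (TableM.at-T-last m) (cong suc (TableM.at-T m _ (∸-monoʳ-≤ (suc m) 1≤Am)))

record Split (m : ℕ) : Set where
  field
    spot-pos    : 1 ≤ S₁ (suc m)
    spot≤       : S₁ (suc m) ≤ m
    spot+parent : S₁ (suc m) + A m ≡ suc m
    recurrence  : A (suc m) ≡ A (S₁ (suc m)) + A (A m)

split : ∀ m → 2 ≤ m → 1 ≤ A m → A m ≤ m → Split m
split m 2≤m 1≤Am Am≤m = record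
  { spot-pos    = m<n⇒0<n∸m (s≤s Am≤m)
  ; spot≤       = ∸-monoʳ-≤ (suc m) 1≤Am
  ; spot+parent = m∸n+n≡m (m≤n⇒m≤1+n Am≤m)
  ; recurrence  = A-rec m 2≤m 1≤Am Am≤m
  }

double : ∀ x → 2 * x ≡ x + x
double x = cong (x +_) (+-identityʳ x)

2≤2^suc : ∀ k → 2 ≤ 2 ^ suc k
2≤2^suc k = *-monoʳ-≤ 2 (m^n>0 2 k)

spot-upper : ∀ {m K} p → m ≤ 2 * p → suc m ≤ 2 * K → suc m ∸ p ≤ K
spot-upper {m} {K} p m≤2p 1+m≤2K = m≤n+o⇒m∸n≤o (suc m) p 1+m≤p+K
  where
  open ≤-Reasoning
  1+m≤p+K : suc m ≤ p + K
  1+m≤p+K with K ≤? p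
  ... | yes K≤p = begin
    suc m    ≤⟨ 1+m≤2K ⟩
    2 * K    ≡⟨ double K ⟩
    K + K    ≤⟨ +-monoˡ-≤ K K≤p ⟩
    p + K    ∎
  ... | no K≰p = begin
    suc m          ≤⟨ s≤s m≤2p ⟩
    suc (2 * p)    ≡⟨ cong suc (double p) ⟩
    suc (p + p)    ≡⟨ sym (+-suc p p) ⟩
    p + suc p      ≤⟨ +-monoʳ-≤ p (≰⇒> K≰p) ⟩
    p + K          ∎

+-gap : ∀ {x y} a b c d → a + c ≤ x → b + d ≤ y → (a + b) + (c + d) ≤ x + y
+-gap {x} {y} a b c d ac bd = subst (_≤ x + y) (interchange a c b d) (+-mono-≤ ac bd)

spot-lower : ∀ {m p a} → p + a ≤ m → a < suc m ∸ p
spot-lower {m} {p} {a} p+a≤m =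
  m+n≤o⇒m≤o∸n (suc a) (s≤s (subst (_≤ m) (+-comm p a) p+a≤m))

record Balanced (x a : ℕ) : Set where
  field
    positive   : 1 ≤ a
    below      : a ≤ x
    above-half : x ≤ 2 * a
open Balanced

Balanced-+ : ∀ {x y a b} → Balanced x a → Balanced y b → Balanced (x + y) (a + b)
Balanced-+ {x} {y} {a} {b} xa yb = record
  { positive   = ≤-trans (positive xa) (m≤m+n a b)
  ; below      = +-mono-≤ (below xa) (below yb)
  ; above-half = subst (x + y ≤_) (sym (*-distribˡ-+ 2 a b))
                   (+-mono-≤ (above-half xa) (above-half yb))
  }

-- The recurrence writes (n, A n) as the sum of (S₁ n, A (S₁ n)) and
-- (A(n−1), A(A(n−1))), so the bounds follow by strong induction.
A-balanced : ∀ n → 1 ≤ n → Balanced n (A n)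
A-balanced = <-rec _ step
  where
  step : ∀ n → (∀ {i} → i < n → 1 ≤ i → Balanced i (A i)) → 1 ≤ n → Balanced n (A n)
  step 1 _ _ = record { positive = s≤s z≤n ; below = s≤s z≤n ; above-half = s≤s z≤n }
  step 2 _ _ = record { positive = s≤s z≤n ; below = s≤s z≤n ; above-half = s≤s (s≤s z≤n) }
  step (suc m@(suc (suc _))) ih _ =
    subst₂ Balanced (Split.spot+parent sp) (sym (Split.recurrence sp))
      (Balanced-+ (ih (s≤s (Split.spot≤ sp)) (Split.spot-pos sp))
                  (ih (s≤s (below bal)) (positive bal)))
    where
    bal : Balanced m (A m)
    bal = ih ≤-refl (s≤s z≤n)
    sp : Split m
    sp = split m (s≤s (s≤s z≤n)) (positive bal) (below bal)

conway-split : ∀ m → 2 ≤ m → Split m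
conway-split m 2≤m = split m 2≤m (positive bal) (below bal)
  where
  bal : Balanced m (A m)
  bal = A-balanced m (≤-trans (s≤s z≤n) 2≤m)

A-upper : ∀ n k → n ≤ 2 ^ suc k → A n ≤ 2 ^ k
A-upper = <-rec _ step
  where
  step : ∀ n → (∀ {i} → i < n → ∀ k → i ≤ 2 ^ suc k → A i ≤ 2 ^ k) →
         ∀ k → n ≤ 2 ^ suc k → A n ≤ 2 ^ k
  step zero _ _ _ = z≤n
  step 1    _ k _ = m^n>0 2 k
  step 2    _ k _ = m^n>0 2 k
  step (suc (suc (suc _))) _ zero (s≤s (s≤s ()))
  step (suc m@(suc (suc _))) ih (suc k) n≤2^[k+2] = begin
    A (suc m)                  ≡⟨ Split.recurrence sp ⟩
    A (S₁ (suc m)) + A (A m)   ≤⟨ +-mono-≤ (ih (s≤s (Split.spot≤ sp)) k spot≤)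
                                           (ih (s≤s (below bal)) k parent≤) ⟩
    2 ^ k + 2 ^ k              ≡⟨ sym (double (2 ^ k)) ⟩
    2 ^ suc k                  ∎
    where
    open ≤-Reasoning
    sp : Split m
    sp = conway-split m (s≤s (s≤s z≤n))
    bal : Balanced m (A m)
    bal = A-balanced m (s≤s z≤n)
    spot≤ : S₁ (suc m) ≤ 2 ^ suc k
    spot≤ = spot-upper (A m) (above-half bal) n≤2^[k+2]
    parent≤ : A m ≤ 2 ^ suc k
    parent≤ = ih ≤-refl (suc k) (≤-trans (n≤1+n m) n≤2^[k+2])

A-gap : ∀ m j → 2 ^ suc j ≤ m → A m + 2 ^ j ≤ m
A-gap = <-rec _ step
  where
  step : ∀ m → (∀ {i} → i < m → ∀ j → 2 ^ suc j ≤ i → A i + 2 ^ j ≤ i) →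
         ∀ j → 2 ^ suc j ≤ m → A m + 2 ^ j ≤ m
  step m ih j 2^[j+1]≤m with m≤n⇒m<n∨m≡n 2^[j+1]≤m
  ... | inj₂ refl = subst (A m + 2 ^ j ≤_) (sym (double (2 ^ j)))
                          (+-monoˡ-≤ (2 ^ j) (A-upper m j ≤-refl))
  step (suc m) ih j _ | inj₁ (s≤s 2^[j+1]≤m) = begin
    A (suc m) + 2 ^ j                       ≡⟨ cong (_+ 2 ^ j) (Split.recurrence sp) ⟩
    (A (S₁ (suc m)) + A (A m)) + 2 ^ j      ≤⟨ gap-sum j 2^[j+1]≤m 2^j<spot ⟩
    S₁ (suc m) + A m                        ≡⟨ Split.spot+parent sp ⟩
    suc m                                   ∎
    where
    open ≤-Reasoning
    2≤m : 2 ≤ m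
    2≤m = ≤-trans (2≤2^suc j) 2^[j+1]≤m
    sp : Split m
    sp = conway-split m 2≤m
    bal : Balanced m (A m)
    bal = A-balanced m (≤-trans (s≤s z≤n) 2≤m)
    spot<1+m : S₁ (suc m) < suc m
    spot<1+m = s≤s (Split.spot≤ sp)
    parent<1+m : A m < suc m
    parent<1+m = s≤s (below bal)
    2^j<spot : 2 ^ j < S₁ (suc m)
    2^j<spot = spot-lower (ih ≤-refl j 2^[j+1]≤m)
    gap-sum : ∀ i → 2 ^ suc i ≤ m → 2 ^ i < S₁ (suc m) →
              A (S₁ (suc m)) + A (A m) + 2 ^ i ≤ S₁ (suc m) + A m
    gap-sum zero _ 1<spot =
      +-gap (A (S₁ (suc m))) (A (A m)) 1 0
        (ih spot<1+m zero 1<spot)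
        (subst (_≤ A m) (sym (+-identityʳ (A (A m)))) (below (A-balanced (A m) (positive bal))))
    gap-sum (suc i) 2^[i+2]≤m 2^[i+1]<spot =
      subst (λ e → A (S₁ (suc m)) + A (A m) + e ≤ S₁ (suc m) + A m) (sym (double (2 ^ i)))
      (+-gap (A (S₁ (suc m))) (A (A m)) (2 ^ i) (2 ^ i)
               (ih spot<1+m i (<⇒≤ 2^[i+1]<spot))
               (ih parent<1+m i (*-cancelˡ-≤ 2 (≤-trans 2^[i+2]≤m (above-half bal)))))

-- M₁ equals k + 1 on the dyadic block 2^k < n ≤ 2^(k+1): the spot of such
-- an n lies in the previous block by spot-lower/A-gap and spot-upper.
M₁-block : ∀ k n → 2 ^ k < n → n ≤ 2 ^ suc k → M₁ n ≡ suc k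
M₁-block zero 2 _ _ = refl
M₁-block zero zero () _
M₁-block zero 1 (s≤s ()) _
M₁-block zero (suc (suc (suc _))) _ (s≤s (s≤s ()))
M₁-block (suc k) zero () _
M₁-block (suc k) (suc m) (s≤s 2^[k+1]≤m) n≤2^[k+2] =
  trans (M-rec m 2≤m (positive bal))
        (cong suc (M₁-block k (S₁ (suc m)) (spot-lower (A-gap m k 2^[k+1]≤m))
                                           (spot-upper (A m) (above-half bal) n≤2^[k+2])))
  where
  2≤m : 2 ≤ m
  2≤m = ≤-trans (2≤2^suc k) 2^[k+1]≤m
  bal : Balanced m (A m)
  bal = A-balanced m (≤-trans (s≤s z≤n) 2≤m)

M₁-upper : ∀ k n → 1 ≤ n → n ≤ 2 ^ suc k → M₁ n ≤ suc k
M₁-upper zero 1 _ _ = ≤-refl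
M₁-upper zero 2 _ _ = ≤-refl
M₁-upper zero (suc (suc (suc _))) _ (s≤s (s≤s ()))
M₁-upper (suc k) n 1≤n n≤2^[k+2] with n ≤? 2 ^ suc k
... | yes n≤2^[k+1] = m≤n⇒m≤1+n (M₁-upper k n 1≤n n≤2^[k+1])
... | no n≰2^[k+1]  = ≤-reflexive (M₁-block (suc k) n (≰⇒> n≰2^[k+1]) n≤2^[k+2])

-- α₁(g) = 2^(g−1) + 1 for g > 1: this index is the first of block g − 1,
-- and every earlier index lies in a generation ≤ g − 1.
proposition1 : (g : ℕ) → 1 < g →
    (M₁ (2 ^ (g ∸ 1) + 1) ≡ g)
    × ((n : ℕ) → 1 ≤ n → n < 2 ^ (g ∸ 1) + 1 → M₁ n ≢ g)
proposition1 (suc zero) (s≤s ())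
proposition1 (suc (suc h)) _ = first-index , earlier-indices
  where
  N : ℕ
  N = 2 ^ suc h
  first-index : M₁ (N + 1) ≡ suc (suc h)
  first-index = M₁-block (suc h) (N + 1)
    (subst (N <_) (+-comm 1 N) ≤-refl)
    (subst (N + 1 ≤_) (sym (double N)) (+-monoʳ-≤ N (m^n>0 2 (suc h))))
  earlier-indices : (n : ℕ) → 1 ≤ n → n < N + 1 → M₁ n ≢ suc (suc h)
  earlier-indices n 1≤n n<N+1 M₁n≡g = 1+n≰n (subst (_≤ suc h) M₁n≡g
    (M₁-upper h n 1≤n (≤-pred (subst (n <_) (+-comm N 1) n<N+1))))
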